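{- Let $v\ge 1$, $k\ge 1$ and $0\le t\le k$ be integers, and let $M=M_t(v,k)$ be the $t$-inclusion matrix defined in the context, regarded as a matrix over the real numbers. Then \[ \operatorname{rank}(M)=\sum_{i=0}^{t}\binom{k}{i}(v-1)^i . \]
   Context: Let $V=\{0,1,\ldots,v-1\}$ and $V^k$ the set of ordered $k$-tuples of elements of $V$. For a $t$-subset $I=\{i_1<\cdots<i_t\}$ of $\{1,\ldots,k\}$, let $V^t_I=\{(u_1,\ldots,u_t)_I : u_j\in V\}$ (tuples labelled by $I$). Say $(u_1,\ldots,u_t)_I\in(x_1,\ldots,x_k)$ iff $u_j=x_{i_j}$ for $j=1,\ldots,t$. The $t$-inclusion matrix $M_t(v,k)$ has columns indexed by $V^k$ and rows indexed by $\bigcup_I V^t_I$, the union over all $t$-subsets $I$ of $\{1,\ldots,k\}$; the entry in row $(u_1,\ldots,u_t)_I$ and column $(x_1,\ldots,x_k)$ is $1$ if $(u_1,\ldots,u_t)_I\in(x_1,\ldots,x_k)$ and $0$ otherwise.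
   Formalization: The rank of $M$ is taken over ℚ, with rational coefficients in the linear combinations of columns, instead of over the real numbers. -}

module Defs where

open import Data.Nat as ℕ using (ℕ; zero; suc; _∸_; _^_)
open import Data.Nat.Combinatorics using (_C_)
open import Data.Fin using (Fin; zero; suc; _<_)
open import Data.Fin.Properties using (all?; _≟_)
open import Data.Rational using (ℚ; 0ℚ; 1ℚ; _+_; _*_)
open import Data.List using (map; upTo)
open import Data.Nat.ListAction using (sum)
open import Data.Product using (Σ; ∃; _×_; _,_; proj₁; proj₂)
open import Data.Bool using (if_then_else_)
open import Relation.Nullary using (¬_; does)
open import Relation.Binary.PropositionalEquality using (_≡_)

∑ : (r : ℕ) → (Fin r → ℚ) → ℚ
∑ zero    f = 0ℚ
∑ (suc r) f = f zero + ∑ r (λ j → f (suc j))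

-- a t-subset I = {i_1 < ... < i_t} of {1..k}, given by its increasing enumeration
TSubset : ℕ → ℕ → Set
TSubset t k = Σ (Fin t → Fin k) (λ I → ∀ a b → a < b → I a < I b)

-- row indices: (u_1,...,u_t)_I ; column indices: (x_1,...,x_k) ∈ V^k
Row : (v t k : ℕ) → Set
Row v t k = TSubset t k × (Fin t → Fin v)

Col : (v k : ℕ) → Set
Col v k = Fin k → Fin v

_∈ᵗ_ : ∀ {v t k} → Row v t k → Col v k → Set
((I , _) , u) ∈ᵗ x = ∀ j → u j ≡ x (I j)

M : (t v k : ℕ) → Row v t k → Col v k → ℚ
M t v k ((I , p) , u) x = if does (all? (λ j → u j ≟ x (I j))) then 1ℚ else 0ℚ

LinIndep : {R : Set} (r : ℕ) → (Fin r → R → ℚ) → Set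
LinIndep {R} r f = (c : Fin r → ℚ) → (∀ row → ∑ r (λ j → c j * f j row) ≡ 0ℚ) → ∀ j → c j ≡ 0ℚ

HasRank : {R C : Set} → (R → C → ℚ) → ℕ → Set
HasRank {R} {C} A r =
  (Σ (Fin r → C) λ cols → LinIndep r (λ j row → A row (cols j)))
  × ((cols : Fin (suc r) → C) → ¬ LinIndep (suc r) (λ j row → A row (cols j)))

rankFormula : (v k t : ℕ) → ℕ
rankFormula v k t = sum (map (λ i → (k C i) ℕ.* (v ∸ 1) ^ i) (upTo (suc t)))

module Submission where

-- Say that a function h on columns *respects* a matrix A when every linear
-- relation among columns of A is also satisfied by h (h lies in the row space of
-- A).  If every row of A respects B and every row of B respects A, the two
-- matrices have the same independent families of columns; so when B has n rows
-- and n independent columns, A has rank n (`rank-from-basis`, whose upper half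
-- is Gaussian elimination, `dependent`).  For B we take the matrix `G k t` of the
-- indicator products ∏_{i∈S} [x i = a i] with |S| ≤ t and all labels a i ≠ 0;
-- it has N k t = ∑_{i≤t} C(k,i) wⁱ rows (`N≡rankFormula`).  Then
--   * `G k t` is unitriangular on suitable columns `X k t` (`indep-X`);
--   * every row of M_t is a monomial of degree t, spanned by `G k t` by means of
--     [b = 0] = 1 - ∑_{a≠0} [b = a] (`rows-spanned`);
--   * every row of `G k t` respects M_t, as lower-degree rows of M are sums of
--     rows of M_t (`G-respects-M`).
-- All three follow the recursion N (k+1) (t+1) = N k (t+1) + w · N k t, along
-- which `G` and `X` are defined as block concatenations.

open import Defs
open import Data.Nat as ℕ using (ℕ; zero; suc; _≤_; _≥_; s≤s; z≤n; _⊓_)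
import Data.Nat.Properties as ℕ
open import Data.Nat.Combinatorics using (_C_; k>n⇒nCk≡0; nCk+nC[k+1]≡[n+1]C[k+1])
open import Data.Nat.ListAction using (sum)
open import Data.Nat.Tactic.RingSolver using (solve-∀)
open import Data.List using (List; []; _∷_; length; applyUpTo)
open import Data.List.Properties using (map-upTo)
open import Data.Fin using (Fin; zero; suc; _↑ˡ_; _↑ʳ_; splitAt; join; combine; remQuot; punchIn)
import Data.Fin.Properties as Fin
open import Data.Fin.Properties using (_≟_; all?)
open import Data.Vec.Functional using (_++_; concat; insertAt; tail) renaming (_∷_ to _∷ᵥ_)
open import Data.Vec.Functional.Properties using (lookup-++ˡ; lookup-++ʳ; insertAt-lookup; insertAt-punchIn)
open import Data.Rational using (ℚ; 0ℚ; 1ℚ; _+_; _*_; -_; _-_; 1/_)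
import Data.Rational.Properties as ℚ
open import Data.Rational.Base using (≢-nonZero)
open import Data.Rational.Solver using (module +-*-Solver)
open import Algebra.Bundles using (CommutativeRing)
import Algebra.Properties.Semiring.Sum (CommutativeRing.semiring ℚ.+-*-commutativeRing) as Σℚ
open import Data.Bool using (if_then_else_)
open import Data.Product using (_×_; _,_; proj₁; proj₂; uncurry)
open import Data.Sum using (_⊎_; inj₁; inj₂)
import Data.Sum
open import Data.Empty using (⊥-elim)
open import Function using (_∘_)
open import Relation.Nullary using (¬_; Dec; yes; no; does; ¬?)
open import Relation.Nullary.Decidable using (decidable-stable)
open import Relation.Binary.PropositionalEquality

open +-*-Solver using (solve; _:+_; _:*_; :-_; _:=_; con)

∑≡sum : ∀ r (f : Fin r → ℚ) → ∑ r f ≡ Σℚ.sum f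
∑≡sum zero    f = refl
∑≡sum (suc r) f = cong (f zero +_) (∑≡sum r (f ∘ suc))

∑-cong : ∀ r {f g : Fin r → ℚ} → (∀ i → f i ≡ g i) → ∑ r f ≡ ∑ r g
∑-cong r {f} {g} f≗g = trans (∑≡sum r f) (trans (Σℚ.sum-cong-≗ f≗g) (sym (∑≡sum r g)))

∑-zero : ∀ r {f : Fin r → ℚ} → (∀ i → f i ≡ 0ℚ) → ∑ r f ≡ 0ℚ
∑-zero r f≗0 = trans (∑-cong r f≗0) (trans (∑≡sum r _) (Σℚ.sum-replicate-zero r))

∑-+ : ∀ r (f g : Fin r → ℚ) → ∑ r (λ i → f i + g i) ≡ ∑ r f + ∑ r g
∑-+ r f g = trans (∑≡sum r _)
  (trans (Σℚ.∑-distrib-+ f g) (sym (cong₂ _+_ (∑≡sum r f) (∑≡sum r g))))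

∑-*ˡ : ∀ r a (f : Fin r → ℚ) → ∑ r (λ i → a * f i) ≡ a * ∑ r f
∑-*ˡ r a f = trans (∑≡sum r _) (sym (trans (cong (a *_) (∑≡sum r f)) (Σℚ.*-distribˡ-sum a f)))

∑-comm : ∀ m n (f : Fin m → Fin n → ℚ) →
         ∑ m (λ i → ∑ n (f i)) ≡ ∑ n (λ j → ∑ m (λ i → f i j))
∑-comm m n f = begin
  ∑ m (λ i → ∑ n (f i))                 ≡⟨ ∑-cong m (λ i → ∑≡sum n (f i)) ⟩
  ∑ m (λ i → Σℚ.sum (f i))              ≡⟨ ∑≡sum m _ ⟩
  Σℚ.sum (λ i → Σℚ.sum (f i))           ≡⟨ Σℚ.∑-comm f ⟩
  Σℚ.sum (λ j → Σℚ.sum (λ i → f i j))   ≡⟨ sym (∑≡sum n _) ⟩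
  ∑ n (λ j → Σℚ.sum (λ i → f i j))      ≡⟨ sym (∑-cong n (λ j → ∑≡sum m (λ i → f i j))) ⟩
  ∑ n (λ j → ∑ m (λ i → f i j))         ∎
  where open ≡-Reasoning

∑-remove : ∀ r (i : Fin (suc r)) (f : Fin (suc r) → ℚ) → ∑ (suc r) f ≡ f i + ∑ r (f ∘ punchIn i)
∑-remove r i f = trans (∑≡sum (suc r) f)
  (trans (Σℚ.sum-remove f) (cong (f i +_) (sym (∑≡sum r (f ∘ punchIn i)))))

∑-single : ∀ r (i : Fin r) (f : Fin r → ℚ) → (∀ j → j ≢ i → f j ≡ 0ℚ) → ∑ r f ≡ f i
∑-single (suc r) i f off-i = begin
  ∑ (suc r) f                    ≡⟨ ∑-remove r i f ⟩
  f i + ∑ r (f ∘ punchIn i)      ≡⟨ cong (f i +_) (∑-zero r (λ j → off-i _ (Fin.punchInᵢ≢i i j))) ⟩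
  f i + 0ℚ                       ≡⟨ ℚ.+-identityʳ (f i) ⟩
  f i                            ∎
  where open ≡-Reasoning

∑-++ : ∀ m n (f : Fin (m ℕ.+ n) → ℚ) → ∑ (m ℕ.+ n) f ≡ ∑ m (f ∘ (_↑ˡ n)) + ∑ n (f ∘ (m ↑ʳ_))
∑-++ zero    n f = sym (ℚ.+-identityˡ _)
∑-++ (suc m) n f = trans (cong (f zero +_) (∑-++ m n (f ∘ suc))) (sym (ℚ.+-assoc (f zero) _ _))

∑-combine : ∀ w n (f : Fin (w ℕ.* n) → ℚ) → ∑ (w ℕ.* n) f ≡ ∑ w (λ a → ∑ n (λ P → f (combine a P)))
∑-combine zero    n f = refl
∑-combine (suc w) n f =
  trans (∑-++ n (w ℕ.* n) f) (cong (∑ n (f ∘ (_↑ˡ (w ℕ.* n))) +_) (∑-combine w n (f ∘ (n ↑ʳ_))))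

∀-++ : ∀ m n {P : Fin (m ℕ.+ n) → Set} → (∀ i → P (i ↑ˡ n)) → (∀ j → P (m ↑ʳ j)) → ∀ k → P k
∀-++ m n {P} left right k = subst P (Fin.join-splitAt m n k) (by-block (splitAt m k))
  where
  by-block : ∀ s → P (join m n s)
  by-block (inj₁ i) = left i
  by-block (inj₂ j) = right j

∀-combine : ∀ w n {P : Fin (w ℕ.* n) → Set} → (∀ a Q → P (combine a Q)) → ∀ k → P k
∀-combine w n {P} block k =
  subst P (Fin.combine-remQuot {w} n k) (block (proj₁ (remQuot {w} n k)) (proj₂ (remQuot {w} n k)))

concat-combine : ∀ {A : Set} {w n} (xss : Fin w → Fin n → A) a Q → concat xss (combine a Q) ≡ xss a Q
concat-combine xss a Q = cong (uncurry xss) (Fin.remQuot-combine a Q)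

𝟙 : ∀ {A : Set} → Dec A → ℚ
𝟙 d = if does d then 1ℚ else 0ℚ

δ : ∀ {n} → Fin n → Fin n → ℚ
δ a b = 𝟙 (a ≟ b)

δ-≢ : ∀ {n} {a b : Fin n} → a ≢ b → δ a b ≡ 0ℚ
δ-≢ {a = a} {b} a≢b with a ≟ b
... | yes a≡b = ⊥-elim (a≢b a≡b)
... | no  _   = refl

δ-refl : ∀ {n} (a : Fin n) → δ a a ≡ 1ℚ
δ-refl a with a ≟ a
... | yes _   = refl
... | no  a≢a = ⊥-elim (a≢a refl)

∑-δ : ∀ n (f : Fin n → ℚ) b → ∑ n (λ a → δ a b * f a) ≡ f b
∑-δ n f b = trans (∑-single n b _ (λ a a≢b → trans (cong (_* f a) (δ-≢ a≢b)) (ℚ.*-zeroˡ (f a))))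
                  (trans (cong (_* f b) (δ-refl b)) (ℚ.*-identityˡ (f b)))

𝟙-yes : ∀ {A : Set} (d : Dec A) → A → 𝟙 d ≡ 1ℚ
𝟙-yes (yes _) _ = refl
𝟙-yes (no ¬a) a = ⊥-elim (¬a a)

𝟙-no : ∀ {A : Set} (d : Dec A) → ¬ A → 𝟙 d ≡ 0ℚ
𝟙-no (yes a) ¬a = ⊥-elim (¬a a)
𝟙-no (no _)  _  = refl

𝟙-all : ∀ t {P : Fin (suc t) → Set} (P? : ∀ j → Dec (P j)) →
        𝟙 (all? P?) ≡ 𝟙 (P? zero) * 𝟙 (all? (P? ∘ suc))
𝟙-all t {P} P? = factor (P? zero) (all? (P? ∘ suc))
  where
  factor : (d₀ : Dec (P zero)) (ds : Dec (∀ j → P (suc j))) → 𝟙 (all? P?) ≡ 𝟙 d₀ * 𝟙 ds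
  factor (yes p₀) (yes ps) = 𝟙-yes (all? P?) (λ { zero → p₀ ; (suc j) → ps j })
  factor (yes _)  (no ¬ps) = 𝟙-no (all? P?) (λ p → ¬ps (p ∘ suc))
  factor (no ¬p₀) ds       = trans (𝟙-no (all? P?) (λ p → ¬p₀ (p zero))) (sym (ℚ.*-zeroˡ (𝟙 ds)))

cancel-nonzero : ∀ a b → a ≢ 0ℚ → a * b ≡ 0ℚ → b ≡ 0ℚ
cancel-nonzero a b a≢0 ab≡0 = begin
  b                  ≡⟨ sym (ℚ.*-identityˡ b) ⟩
  1ℚ * b             ≡⟨ cong (_* b) (sym (ℚ.*-inverseˡ a)) ⟩
  (1/ a) * a * b     ≡⟨ ℚ.*-assoc (1/ a) a b ⟩
  (1/ a) * (a * b)   ≡⟨ cong ((1/ a) *_) ab≡0 ⟩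
  (1/ a) * 0ℚ        ≡⟨ ℚ.*-zeroʳ (1/ a) ⟩
  0ℚ                 ∎
  where
  open ≡-Reasoning
  instance _ = ≢-nonZero a≢0

LinIndep-cong : ∀ {R : Set} m {f g : Fin m → R → ℚ} → (∀ j r → f j r ≡ g j r) → LinIndep m f → LinIndep m g
LinIndep-cong m f≗g indep c rel = indep c (λ r → trans (∑-cong m (λ j → cong (c j *_) (f≗g j r))) (rel r))

-- Gaussian elimination.  A coordinate on which all vectors vanish can be dropped ...
indep-drop-zero : ∀ m n (g : Fin m → Fin (suc n) → ℚ) → (∀ j → g j zero ≡ 0ℚ) →
                  LinIndep m g → LinIndep m (λ j r → g j (suc r))
indep-drop-zero m n g g≡0 indep c rel = indep c λ
  { zero    → ∑-zero m (λ j → trans (cong (c j *_) (g≡0 j)) (ℚ.*-zeroʳ (c j)))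
  ; (suc r) → rel r }

-- ... and otherwise a pivot `g p zero ≠ 0` clears the first coordinate of the other vectors.
indep-eliminate : ∀ m n (g : Fin (suc m) → Fin (suc n) → ℚ) (p : Fin (suc m)) →
                  g p zero ≢ 0ℚ → LinIndep (suc m) g →
                  LinIndep m (λ i r → g p zero * g (punchIn p i) (suc r) - g (punchIn p i) zero * g p (suc r))
indep-eliminate m n g p a≢0 indep d rel i =
  cancel-nonzero a (d i) a≢0 (trans (sym (insertAt-punchIn ad p (- S) i)) (indep c c-rel (punchIn p i)))
  where
  a : ℚ
  a = g p zero
  ad : Fin m → ℚ
  ad i = a * d i
  T : Fin (suc n) → ℚ
  T r = ∑ m (λ i → d i * g (punchIn p i) r)
  S : ℚ
  S = T zero
  c : Fin (suc m) → ℚ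
  c = insertAt ad p (- S)
  c-sum : ∀ r → ∑ (suc m) (λ j → c j * g j r) ≡ - S * g p r + a * T r
  c-sum r = begin
    ∑ (suc m) (λ j → c j * g j r)
      ≡⟨ ∑-remove m p (λ j → c j * g j r) ⟩
    c p * g p r + ∑ m (λ i → c (punchIn p i) * g (punchIn p i) r)
      ≡⟨ cong₂ _+_ (cong (_* g p r) (insertAt-lookup ad p (- S)))
                   (∑-cong m (λ i → trans (cong (_* g (punchIn p i) r) (insertAt-punchIn ad p (- S) i))
                                          (ℚ.*-assoc a (d i) _))) ⟩
    - S * g p r + ∑ m (λ i → a * (d i * g (punchIn p i) r))
      ≡⟨ cong (- S * g p r +_) (∑-*ˡ m a _) ⟩
    - S * g p r + a * T r ∎
    where open ≡-Reasoning
  c-rel : ∀ r → ∑ (suc m) (λ j → c j * g j r) ≡ 0ℚ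
  c-rel zero    = trans (c-sum zero) (solve 2 (λ S a → (:- S) :* a :+ a :* S := con 0ℚ) refl S a)
  c-rel (suc r) = begin
    ∑ (suc m) (λ j → c j * g j (suc r))
      ≡⟨ c-sum (suc r) ⟩
    - S * Z + a * T (suc r)
      ≡⟨ solve 4 (λ S Z a T → (:- S) :* Z :+ a :* T := a :* T :+ (:- Z) :* S) refl S Z a (T (suc r)) ⟩
    a * T (suc r) + - Z * S
      ≡⟨ sym (trans (∑-+ m _ _) (cong₂ _+_ (∑-*ˡ m a _) (∑-*ˡ m (- Z) _))) ⟩
    ∑ m (λ i → a * (d i * X i) + - Z * (d i * Y i))
      ≡⟨ ∑-cong m (λ i → solve 5 (λ a Z d X Y → a :* (d :* X) :+ (:- Z) :* (d :* Y) := d :* (a :* X :+ :- (Y :* Z)))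
                                 refl a Z (d i) (X i) (Y i)) ⟩
    ∑ m (λ i → d i * (a * X i - Y i * Z))
      ≡⟨ rel r ⟩
    0ℚ ∎
    where
    open ≡-Reasoning
    Z : ℚ
    Z = g p (suc r)
    X Y : Fin m → ℚ
    X i = g (punchIn p i) (suc r)
    Y i = g (punchIn p i) zero

dependent : ∀ n m → n ℕ.< m → (g : Fin m → Fin n → ℚ) → ¬ LinIndep m g
dependent zero    (suc m) _         g indep = ℚ.1≢0 (indep (λ _ → 1ℚ) (λ ()) zero)
dependent (suc n) (suc m) (s≤s n<m) g indep with Fin.any? (λ j → ¬? (g j zero ℚ.≟ 0ℚ))
... | yes (p , a≢0) = dependent n m n<m _ (indep-eliminate m n g p a≢0 indep)
... | no  no-pivot  =
  dependent n (suc m) (ℕ.m<n⇒m<1+n n<m) (λ j r → g j (suc r)) (indep-drop-zero (suc m) n g column-zero indep)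
  where
  column-zero : ∀ j → g j zero ≡ 0ℚ
  column-zero j = decidable-stable (g j zero ℚ.≟ 0ℚ) (λ g≢0 → no-pivot (j , g≢0))

indep-unit : ∀ {R : Set} (r : R) → LinIndep 1 (λ _ _ → 1ℚ)
indep-unit r c rel zero = trans (solve 1 (λ c → c := c :* con 1ℚ :+ con 0ℚ) refl (c zero)) (rel r)

LinIndep-split : ∀ {R S₁ S₂ : Set} m n (vs : Fin (m ℕ.+ n) → R → ℚ) (e₁ : S₁ → R) (e₂ : S₂ → R) →
                 LinIndep m (λ i s → vs (i ↑ˡ n) (e₁ s)) →
                 (∀ i s → vs (i ↑ˡ n) (e₂ s) ≡ 0ℚ) →
                 LinIndep n (λ j s → vs (m ↑ʳ j) (e₂ s)) →
                 LinIndep (m ℕ.+ n) vs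
LinIndep-split m n vs e₁ e₂ indep₁ vanish indep₂ c rel = ∀-++ m n c₁≡0 c₂≡0
  where
  c₁ : Fin m → ℚ
  c₁ i = c (i ↑ˡ n)
  c₂ : Fin n → ℚ
  c₂ j = c (m ↑ʳ j)
  split-rel : ∀ r → ∑ m (λ i → c₁ i * vs (i ↑ˡ n) r) + ∑ n (λ j → c₂ j * vs (m ↑ʳ j) r) ≡ 0ℚ
  split-rel r = trans (sym (∑-++ m n _)) (rel r)
  c₂≡0 : ∀ j → c₂ j ≡ 0ℚ
  c₂≡0 = indep₂ c₂ λ s → begin
    ∑ n (λ j → c₂ j * vs (m ↑ʳ j) (e₂ s))
      ≡⟨ sym (ℚ.+-identityˡ _) ⟩
    0ℚ + ∑ n (λ j → c₂ j * vs (m ↑ʳ j) (e₂ s))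
      ≡⟨ cong (_+ ∑ n (λ j → c₂ j * vs (m ↑ʳ j) (e₂ s)))
              (sym (∑-zero m (λ i → trans (cong (c₁ i *_) (vanish i s)) (ℚ.*-zeroʳ (c₁ i))))) ⟩
    ∑ m (λ i → c₁ i * vs (i ↑ˡ n) (e₂ s)) + ∑ n (λ j → c₂ j * vs (m ↑ʳ j) (e₂ s))
      ≡⟨ split-rel (e₂ s) ⟩
    0ℚ ∎
    where open ≡-Reasoning
  c₁≡0 : ∀ i → c₁ i ≡ 0ℚ
  c₁≡0 = indep₁ c₁ λ s → begin
    ∑ m (λ i → c₁ i * vs (i ↑ˡ n) (e₁ s))
      ≡⟨ sym (ℚ.+-identityʳ _) ⟩
    ∑ m (λ i → c₁ i * vs (i ↑ˡ n) (e₁ s)) + 0ℚ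
      ≡⟨ cong (∑ m (λ i → c₁ i * vs (i ↑ˡ n) (e₁ s)) +_)
              (sym (∑-zero n (λ j → trans (cong (_* vs (m ↑ʳ j) (e₁ s)) (c₂≡0 j))
                                          (ℚ.*-zeroˡ (vs (m ↑ʳ j) (e₁ s)))))) ⟩
    ∑ m (λ i → c₁ i * vs (i ↑ˡ n) (e₁ s)) + ∑ n (λ j → c₂ j * vs (m ↑ʳ j) (e₁ s))
      ≡⟨ split-rel (e₁ s) ⟩
    0ℚ ∎
    where open ≡-Reasoning

LinIndep-blocks : ∀ {R S : Set} w n (vs : Fin (w ℕ.* n) → R → ℚ) (e : Fin w → S → R) →
                  (∀ a b P s → a ≢ b → vs (combine a P) (e b s) ≡ 0ℚ) →
                  (∀ a → LinIndep n (λ P s → vs (combine a P) (e a s))) →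
                  LinIndep (w ℕ.* n) vs
LinIndep-blocks w n vs e vanish indep c rel = ∀-combine w n (λ a → indep a (λ P → c (combine a P)) (block-rel a))
  where
  block-rel : ∀ a s → ∑ n (λ P → c (combine a P) * vs (combine a P) (e a s)) ≡ 0ℚ
  block-rel a s = begin
    ∑ n (λ P → c (combine a P) * vs (combine a P) (e a s))
      ≡⟨ sym (∑-single w a _ (λ b b≢a → ∑-zero n (λ P →
               trans (cong (c (combine b P) *_) (vanish b a P s b≢a)) (ℚ.*-zeroʳ (c (combine b P)))))) ⟩
    ∑ w (λ b → ∑ n (λ P → c (combine b P) * vs (combine b P) (e a s)))
      ≡⟨ sym (∑-combine w n (λ j → c j * vs j (e a s))) ⟩
    ∑ (w ℕ.* n) (λ j → c j * vs j (e a s))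
      ≡⟨ rel (e a s) ⟩
    0ℚ ∎
    where open ≡-Reasoning

-- By duality this
-- means that `h` lies in the row space of `A`; only the definition is used here.
record Respects {R C : Set} (A : R → C → ℚ) (h : C → ℚ) : Set where
  constructor respecting
  field
    relation : ∀ m (cols : Fin m → C) (c : Fin m → ℚ) →
               (∀ r → ∑ m (λ j → c j * A r (cols j)) ≡ 0ℚ) → ∑ m (λ j → c j * h (cols j)) ≡ 0ℚ
open Respects

respects-row : ∀ {R C : Set} (A : R → C → ℚ) r → Respects A (A r)
respects-row A r = respecting (λ m cols c rel → rel r)

respects-cong : ∀ {R C : Set} {A : R → C → ℚ} {h h′ : C → ℚ} →
                (∀ x → h x ≡ h′ x) → Respects A h → Respects A h′
respects-cong h≗h′ resp = respecting λ m cols c rel →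
  trans (∑-cong m (λ j → cong (c j *_) (sym (h≗h′ (cols j))))) (relation resp m cols c rel)

respects-trans : ∀ {R S C : Set} {A : R → C → ℚ} (B : S → C → ℚ) {h : C → ℚ} →
                 (∀ s → Respects A (B s)) → Respects B h → Respects A h
respects-trans B B-resp resp = respecting λ m cols c rel →
  relation resp m cols c (λ s → relation (B-resp s) m cols c rel)

respects-lincomb : ∀ {R C : Set} {A : R → C → ℚ} n (ℓ : Fin n → ℚ) (B : Fin n → C → ℚ) {h : C → ℚ} →
                   (∀ x → h x ≡ ∑ n (λ i → ℓ i * B i x)) → (∀ i → Respects A (B i)) → Respects A h
respects-lincomb n ℓ B {h} h≡ B-resp = respecting λ m cols c rel → begin
  ∑ m (λ j → c j * h (cols j))
    ≡⟨ ∑-cong m (λ j → trans (cong (c j *_) (h≡ (cols j))) (sym (∑-*ˡ n (c j) _))) ⟩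
  ∑ m (λ j → ∑ n (λ i → c j * (ℓ i * B i (cols j))))
    ≡⟨ ∑-comm m n _ ⟩
  ∑ n (λ i → ∑ m (λ j → c j * (ℓ i * B i (cols j))))
    ≡⟨ ∑-cong n (λ i → trans (∑-cong m (λ j → swap-factors (c j) (ℓ i) (B i (cols j)))) (∑-*ˡ m (ℓ i) _)) ⟩
  ∑ n (λ i → ℓ i * ∑ m (λ j → c j * B i (cols j)))
    ≡⟨ ∑-zero n (λ i → trans (cong (ℓ i *_) (relation (B-resp i) m cols c rel)) (ℚ.*-zeroʳ (ℓ i))) ⟩
  0ℚ ∎
  where
  open ≡-Reasoning
  swap-factors : ∀ a b c → a * (b * c) ≡ b * (a * c)
  swap-factors = solve 3 (λ a b c → a :* (b :* c) := b :* (a :* c)) refl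

respects-∘ : ∀ {R C D : Set} {A : R → C → ℚ} {h : C → ℚ} (f : D → C) →
             Respects A h → Respects (λ r x → A r (f x)) (h ∘ f)
respects-∘ f resp = respecting λ m cols → relation resp m (f ∘ cols)

respects-scale : ∀ {R C : Set} {A : R → C → ℚ} {h : C → ℚ} (φ : C → ℚ) →
                 Respects A h → Respects (λ r x → φ x * A r x) (λ x → φ x * h x)
respects-scale {A = A} {h} φ resp = respecting λ m cols c rel →
  trans (∑-cong m (λ j → sym (ℚ.*-assoc (c j) (φ (cols j)) (h (cols j)))))
        (relation resp m cols (λ j → c j * φ (cols j))
              (λ r → trans (∑-cong m (λ j → ℚ.*-assoc (c j) (φ (cols j)) (A r (cols j)))) (rel r)))

indep-transfer : ∀ {R S C : Set} (A : R → C → ℚ) (B : S → C → ℚ) → (∀ s → Respects A (B s)) →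
                 ∀ m (cols : Fin m → C) → LinIndep m (λ j s → B s (cols j)) → LinIndep m (λ j r → A r (cols j))
indep-transfer A B B-resp m cols indep c rel = indep c (λ s → relation (B-resp s) m cols c rel)

rank-from-basis : ∀ {R C : Set} (A : R → C → ℚ) n (B : Fin n → C → ℚ) →
                  (∀ r → Respects B (A r)) → (∀ P → Respects A (B P)) →
                  (cols : Fin n → C) → LinIndep n (λ j P → B P (cols j)) → HasRank A n
rank-from-basis A n B A-resp B-resp cols indep =
  (cols , indep-transfer A B B-resp n cols indep) ,
  λ cols′ indep′ → dependent n (suc n) ℕ.≤-refl (λ j P → B P (cols′ j))
                             (indep-transfer B A A-resp (suc n) cols′ indep′)

sumUpTo : (ℕ → ℕ) → ℕ → ℕ
sumUpTo f n = sum (applyUpTo f n)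

sumUpTo-zero : ∀ f n → (∀ i → f i ≡ 0) → sumUpTo f n ≡ 0
sumUpTo-zero f zero    f≡0 = refl
sumUpTo-zero f (suc n) f≡0 = cong₂ ℕ._+_ (f≡0 0) (sumUpTo-zero (f ∘ suc) n (f≡0 ∘ suc))

sumUpTo-linear : ∀ a f g h n → (∀ i → f i ≡ a ℕ.* g i ℕ.+ h i) →
                 sumUpTo f n ≡ a ℕ.* sumUpTo g n ℕ.+ sumUpTo h n
sumUpTo-linear a f g h zero    f≡ = sym (cong (ℕ._+ 0) (ℕ.*-zeroʳ a))
sumUpTo-linear a f g h (suc n) f≡ = begin
  f 0 ℕ.+ sumUpTo (f ∘ suc) n
    ≡⟨ cong₂ ℕ._+_ (f≡ 0) (sumUpTo-linear a (f ∘ suc) (g ∘ suc) (h ∘ suc) n (f≡ ∘ suc)) ⟩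
  (a ℕ.* g 0 ℕ.+ h 0) ℕ.+ (a ℕ.* sumUpTo (g ∘ suc) n ℕ.+ sumUpTo (h ∘ suc) n)
    ≡⟨ regroup a (g 0) (h 0) (sumUpTo (g ∘ suc) n) (sumUpTo (h ∘ suc) n) ⟩
  a ℕ.* (g 0 ℕ.+ sumUpTo (g ∘ suc) n) ℕ.+ (h 0 ℕ.+ sumUpTo (h ∘ suc) n) ∎
  where
  open ≡-Reasoning
  regroup : ∀ a g h G H → (a ℕ.* g ℕ.+ h) ℕ.+ (a ℕ.* G ℕ.+ H) ≡ a ℕ.* (g ℕ.+ G) ℕ.+ (h ℕ.+ H)
  regroup = solve-∀

module Basis (w : ℕ) where

  -- The alphabet is `Fin v` with `v = w + 1`, the symbol `zero` playing a special role.
  v : ℕ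
  v = suc w

  -- `N k t = ∑_{i ≤ t} C(k,i) wⁱ`, computed by the Pascal-type recursion below.
  N : ℕ → ℕ → ℕ
  N zero    t       = 1
  N (suc k) zero    = 1
  N (suc k) (suc t) = N k (suc t) ℕ.+ w ℕ.* N k t

  -- Pascal's rule for the summands `C(k,i) wⁱ` gives the recursion of `N`.
  term : ℕ → ℕ → ℕ
  term k i = (k C i) ℕ.* w ℕ.^ i

  term-pascal : ∀ k i → term (suc k) (suc i) ≡ w ℕ.* term k i ℕ.+ term k (suc i)
  term-pascal k i = begin
    (suc k C suc i) ℕ.* (w ℕ.* w ℕ.^ i)
      ≡⟨ cong (ℕ._* (w ℕ.* w ℕ.^ i)) (sym (nCk+nC[k+1]≡[n+1]C[k+1] k i)) ⟩
    ((k C i) ℕ.+ (k C suc i)) ℕ.* (w ℕ.* w ℕ.^ i)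
      ≡⟨ expand (k C i) (k C suc i) w (w ℕ.^ i) ⟩
    w ℕ.* ((k C i) ℕ.* w ℕ.^ i) ℕ.+ (k C suc i) ℕ.* (w ℕ.* w ℕ.^ i) ∎
    where
    open ≡-Reasoning
    expand : ∀ c c′ w p → (c ℕ.+ c′) ℕ.* (w ℕ.* p) ≡ w ℕ.* (c ℕ.* p) ℕ.+ c′ ℕ.* (w ℕ.* p)
    expand = solve-∀

  N≡sum : ∀ k t → N k t ≡ sumUpTo (term k) (suc t)
  N≡sum zero    t       =
    sym (cong suc (sumUpTo-zero _ t (λ i → cong (ℕ._* w ℕ.^ suc i) (k>n⇒nCk≡0 {0} {suc i} (s≤s z≤n)))))
  N≡sum (suc k) zero    = refl
  N≡sum (suc k) (suc t) = begin
    N k (suc t) ℕ.+ w ℕ.* N k t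
      ≡⟨ cong₂ (λ p q → p ℕ.+ w ℕ.* q) (N≡sum k (suc t)) (N≡sum k t) ⟩
    suc (sumUpTo (term k ∘ suc) (suc t)) ℕ.+ w ℕ.* sumUpTo (term k) (suc t)
      ≡⟨ cong suc (ℕ.+-comm (sumUpTo (term k ∘ suc) (suc t)) _) ⟩
    suc (w ℕ.* sumUpTo (term k) (suc t) ℕ.+ sumUpTo (term k ∘ suc) (suc t))
      ≡⟨ cong suc (sym (sumUpTo-linear w _ (term k) (term k ∘ suc) (suc t) (term-pascal k))) ⟩
    sumUpTo (term (suc k)) (suc (suc t)) ∎
    where open ≡-Reasoning

  N≡rankFormula : ∀ k t → N k t ≡ rankFormula v k t
  N≡rankFormula k t = trans (N≡sum k t) (sym (cong sum (map-upTo (term k) (suc t))))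

  -- The basis functions.  `G k t x` lists, over the sets `S` of at most `t`
  -- coordinates and the labels `a : S → {1..w}`, the indicators `∏_{i∈S} [x i = a i]`:
  -- those not constraining coordinate `zero` first, then, for each label `a`
  -- of coordinate `zero`, the products with `[x zero = a]`.
  G : ∀ k t → Col v k → Fin (N k t) → ℚ
  G zero    t       x = λ _ → 1ℚ
  G (suc k) zero    x = λ _ → 1ℚ
  G (suc k) (suc t) x = G k (suc t) (tail x) ++ concat (λ a Q → δ (suc a) (x zero) * G k t (tail x) Q)

  -- The witness columns: the word with label `a` on `S` and `zero` elsewhere,
  -- enumerated in the same order as `G`.
  X : ∀ k t → Fin (N k t) → Col v k
  X zero    t       _ ()
  X (suc k) zero    _ = λ _ → zero
  X (suc k) (suc t)   = (λ P → zero ∷ᵥ X k (suc t) P) ++ concat (λ a P → suc a ∷ᵥ X k t P)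

  G-first : ∀ k t x Q → G (suc k) (suc t) x (Q ↑ˡ (w ℕ.* N k t)) ≡ G k (suc t) (tail x) Q
  G-first k t x Q = lookup-++ˡ (G k (suc t) (tail x)) _ Q

  G-block : ∀ k t x a Q → G (suc k) (suc t) x (N k (suc t) ↑ʳ combine a Q) ≡ δ (suc a) (x zero) * G k t (tail x) Q
  G-block k t x a Q = trans (lookup-++ʳ (G k (suc t) (tail x)) _ (combine a Q))
                            (concat-combine (λ a Q → δ (suc a) (x zero) * G k t (tail x) Q) a Q)

  X-first : ∀ k t P → X (suc k) (suc t) (P ↑ˡ (w ℕ.* N k t)) ≡ zero ∷ᵥ X k (suc t) P
  X-first k t P = lookup-++ˡ (λ P → zero ∷ᵥ X k (suc t) P) _ P

  X-block : ∀ k t a P → X (suc k) (suc t) (N k (suc t) ↑ʳ combine a P) ≡ suc a ∷ᵥ X k t P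
  X-block k t a P = trans (lookup-++ʳ (λ P → zero ∷ᵥ X k (suc t) P) _ (combine a P))
                          (concat-combine (λ a P → suc a ∷ᵥ X k t P) a P)

  -- The matrix `G` on the columns `X` is unitriangular (block by block), so the
  -- columns `X` are independent for `G`.
  indep-X : ∀ k t → LinIndep (N k t) (λ P Q → G k t (X k t P) Q)
  indep-X zero    t       = indep-unit zero
  indep-X (suc k) zero    = indep-unit zero
  indep-X (suc k) (suc t) =
    LinIndep-split n₁ (w ℕ.* n₂) entry (_↑ˡ (w ℕ.* n₂)) (n₁ ↑ʳ_)
      (LinIndep-cong n₁ (λ P Q → sym (first-entry P Q)) (indep-X k (suc t)))
      (λ P → ∀-combine w n₂ (first-vanishes P))
      (LinIndep-blocks w n₂ _ combine block-vanishes
        (λ a → LinIndep-cong n₂ (λ P Q → sym (diagonal-entry a P Q)) (indep-X k t)))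
    where
    n₁ n₂ : ℕ
    n₁ = N k (suc t)
    n₂ = N k t
    entry : Fin (n₁ ℕ.+ w ℕ.* n₂) → Fin (n₁ ℕ.+ w ℕ.* n₂) → ℚ
    entry P Q = G (suc k) (suc t) (X (suc k) (suc t) P) Q
    first-entry : ∀ P Q → entry (P ↑ˡ (w ℕ.* n₂)) (Q ↑ˡ (w ℕ.* n₂)) ≡ G k (suc t) (X k (suc t) P) Q
    first-entry P Q = trans (cong (λ y → G (suc k) (suc t) y (Q ↑ˡ (w ℕ.* n₂))) (X-first k t P))
                            (G-first k t (zero ∷ᵥ X k (suc t) P) Q)
    -- first columns on block rows: zero, as `x zero = zero` there
    first-vanishes : ∀ P a Q → entry (P ↑ˡ (w ℕ.* n₂)) (n₁ ↑ʳ combine a Q) ≡ 0ℚ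
    first-vanishes P a Q = trans (cong (λ y → G (suc k) (suc t) y (n₁ ↑ʳ combine a Q)) (X-first k t P))
      (trans (G-block k t (zero ∷ᵥ X k (suc t) P) a Q) (ℚ.*-zeroˡ (G k t (X k (suc t) P) Q)))
    block-entry : ∀ a b P Q → entry (n₁ ↑ʳ combine a P) (n₁ ↑ʳ combine b Q) ≡ δ b a * G k t (X k t P) Q
    block-entry a b P Q = trans (cong (λ y → G (suc k) (suc t) y (n₁ ↑ʳ combine b Q)) (X-block k t a P))
                                (G-block k t (suc a ∷ᵥ X k t P) b Q)
    block-vanishes : ∀ a b P Q → a ≢ b → entry (n₁ ↑ʳ combine a P) (n₁ ↑ʳ combine b Q) ≡ 0ℚ
    block-vanishes a b P Q a≢b = trans (block-entry a b P Q)
      (trans (cong (_* G k t (X k t P) Q) (δ-≢ (a≢b ∘ sym))) (ℚ.*-zeroˡ (G k t (X k t P) Q)))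
    diagonal-entry : ∀ a P Q → entry (n₁ ↑ʳ combine a P) (n₁ ↑ʳ combine a Q) ≡ G k t (X k t P) Q
    diagonal-entry a P Q = trans (block-entry a a P Q)
      (trans (cong (_* G k t (X k t P) Q) (δ-refl a)) (ℚ.*-identityˡ (G k t (X k t P) Q)))

  GRow : ∀ k t → Fin (N k t) → Col v k → ℚ
  GRow k t P x = G k t x P

  -- A row
  -- of `M t` is a monomial, a product of factors `φ (x i)` on single coordinates;
  -- coordinates may repeat, which lets monomials be split along coordinate `zero`.
  Monomial : ℕ → Set
  Monomial k = List (Fin k × (Fin v → ℚ))

  eval : ∀ {k} → Monomial k → Col v k → ℚ
  eval []              x = 1ℚ
  eval ((i , φ) ∷ fs)  x = φ (x i) * eval fs x

  split : ∀ {k} → Monomial (suc k) → List (Fin v → ℚ) × Monomial k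
  split []                    = [] , []
  split ((zero  , φ) ∷ fs)    = (φ ∷ proj₁ (split fs)) , proj₂ (split fs)
  split ((suc i , φ) ∷ fs)    = proj₁ (split fs) , ((i , φ) ∷ proj₂ (split fs))

  product : List (Fin v → ℚ) → Fin v → ℚ
  product []       b = 1ℚ
  product (φ ∷ φs) b = φ b * product φs b

  eval-split : ∀ {k} (fs : Monomial (suc k)) x →
               eval fs x ≡ product (proj₁ (split fs)) (x zero) * eval (proj₂ (split fs)) (tail x)
  eval-split []                x = sym (ℚ.*-identityˡ 1ℚ)
  eval-split ((zero  , φ) ∷ fs) x =
    trans (cong (φ (x zero) *_) (eval-split fs x))
          (sym (ℚ.*-assoc (φ (x zero)) (product (proj₁ (split fs)) (x zero)) (eval (proj₂ (split fs)) (tail x))))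
  eval-split ((suc i , φ) ∷ fs) x =
    trans (cong (φ (x (suc i)) *_) (eval-split fs x))
          (solve 3 (λ a b c → a :* (b :* c) := b :* (a :* c)) refl
                 (φ (x (suc i))) (product (proj₁ (split fs)) (x zero)) (eval (proj₂ (split fs)) (tail x)))

  length-split : ∀ {k} (fs : Monomial (suc k)) → length (proj₁ (split fs)) ℕ.+ length (proj₂ (split fs)) ≡ length fs
  length-split []                 = refl
  length-split ((zero  , φ) ∷ fs) = cong suc (length-split fs)
  length-split ((suc i , φ) ∷ fs) = trans (ℕ.+-suc _ _) (cong suc (length-split fs))

  Spanned : ∀ k t → (Col v k → ℚ) → Set
  Spanned k t = Respects (GRow k t)

  spanned-tail : ∀ {k t h} → Spanned k (suc t) h → Spanned (suc k) (suc t) (h ∘ tail)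
  spanned-tail {k} {t} {h} spanned =
    respects-trans {A = GRow (suc k) (suc t)} (λ Q x → G k (suc t) (tail x) Q)
      (λ Q → respects-cong (λ x → G-first k t x Q) (respects-row (GRow (suc k) (suc t)) (Q ↑ˡ (w ℕ.* N k t))))
      (respects-∘ {A = GRow k (suc t)} {h = h} tail spanned)

  spanned-block : ∀ {k t h} a → Spanned k t h → Spanned (suc k) (suc t) (λ x → δ (suc a) (x zero) * h (tail x))
  spanned-block {k} {t} {h} a spanned =
    respects-trans {A = GRow (suc k) (suc t)} (λ Q x → δ (suc a) (x zero) * G k t (tail x) Q)
      (λ Q → respects-cong (λ x → G-block k t x a Q)
                           (respects-row (GRow (suc k) (suc t)) (N k (suc t) ↑ʳ combine a Q)))
      (respects-scale {h = h ∘ tail} (λ x → δ (suc a) (x zero)) (respects-∘ {A = GRow k t} {h = h} tail spanned))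

  expand-coordinate : ∀ (ψ : Fin v → ℚ) H b →
    ψ b * H ≡ ψ zero * H + ∑ w (λ a → (ψ (suc a) - ψ zero) * (δ (suc a) b * H))
  expand-coordinate ψ H zero = sym (trans
    (cong (ψ zero * H +_) (∑-zero w (λ a → trans (cong ((ψ (suc a) - ψ zero) *_) (ℚ.*-zeroˡ H))
                                                 (ℚ.*-zeroʳ (ψ (suc a) - ψ zero)))))
    (ℚ.+-identityʳ (ψ zero * H)))
  expand-coordinate ψ H (suc b) = sym (begin
    ψ zero * H + ∑ w (λ a → (ψ (suc a) - ψ zero) * (δ a b * H))
      ≡⟨ cong (ψ zero * H +_) (∑-single w b _ (λ a a≢b →
           trans (cong (λ d → (ψ (suc a) - ψ zero) * (d * H)) (δ-≢ a≢b))
                 (trans (cong ((ψ (suc a) - ψ zero) *_) (ℚ.*-zeroˡ H)) (ℚ.*-zeroʳ (ψ (suc a) - ψ zero))))) ⟩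
    ψ zero * H + (ψ (suc b) - ψ zero) * (δ b b * H)
      ≡⟨ cong (λ d → ψ zero * H + (ψ (suc b) - ψ zero) * (d * H)) (δ-refl b) ⟩
    ψ zero * H + (ψ (suc b) - ψ zero) * (1ℚ * H)
      ≡⟨ solve 3 (λ p₀ p H → p₀ :* H :+ (p :+ :- p₀) :* (con 1ℚ :* H) := p :* H) refl
                 (ψ zero) (ψ (suc b)) H ⟩
    ψ (suc b) * H ∎)
    where open ≡-Reasoning

  -- A factor `ψ (x zero)` in front of a function of the other coordinates, by the
  -- expansion above: the constant part needs `h` in degree `t+1`, the rest in degree `t`.
  spanned-coordinate : ∀ {k t h} (ψ : Fin v → ℚ) → Spanned k (suc t) h → Spanned k t h →
                       Spanned (suc k) (suc t) (λ x → ψ (x zero) * h (tail x))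
  spanned-coordinate {k} {t} {h} ψ spanned⁺ spanned =
    respects-lincomb {A = GRow (suc k) (suc t)} (suc w) coefficient part
      (λ x → expand-coordinate ψ (h (tail x)) (x zero)) part-spanned
    where
    coefficient : Fin (suc w) → ℚ
    coefficient zero    = ψ zero
    coefficient (suc a) = ψ (suc a) - ψ zero
    part : Fin (suc w) → Col v (suc k) → ℚ
    part zero    x = h (tail x)
    part (suc a) x = δ (suc a) (x zero) * h (tail x)
    part-spanned : ∀ i → Spanned (suc k) (suc t) (part i)
    part-spanned zero    = spanned-tail spanned⁺
    part-spanned (suc a) = spanned-block a spanned

  spanned-monomial : ∀ k t (fs : Monomial k) → length fs ≤ t → Spanned k t (eval fs)
  spanned-monomial zero    t       []               _  = respects-row (GRow zero t) zero
  spanned-monomial zero    t       ((() , _) ∷ _)   _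
  spanned-monomial (suc k) zero    []               _  = respects-row (GRow (suc k) zero) zero
  spanned-monomial (suc k) (suc t) fs               le =
    respects-cong (λ x → sym (eval-split fs x))
      (by-factors (proj₁ (split fs)) (proj₂ (split fs)) (subst (_≤ suc t) (sym (length-split fs)) le))
    where
    by-factors : ∀ φs gs → length φs ℕ.+ length gs ≤ suc t →
                 Spanned (suc k) (suc t) (λ x → product φs (x zero) * eval gs (tail x))
    by-factors []       gs le′       = respects-cong (λ x → sym (ℚ.*-identityˡ (eval gs (tail x))))
                                         (spanned-tail (spanned-monomial k (suc t) gs le′))
    by-factors (φ ∷ φs) gs (s≤s le′) = spanned-coordinate (product (φ ∷ φs))
                                         (spanned-monomial k (suc t) gs (ℕ.m≤n⇒m≤1+n gs≤t))
                                         (spanned-monomial k t gs gs≤t)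
      where
      gs≤t : length gs ≤ t
      gs≤t = ℕ.m+n≤o⇒n≤o (length φs) le′

  rowMonomial : ∀ {k} t → (Fin t → Fin k) → (Fin t → Fin v) → Monomial k
  rowMonomial zero    I u = []
  rowMonomial (suc t) I u = (I zero , δ (u zero)) ∷ rowMonomial t (I ∘ suc) (u ∘ suc)

  length-rowMonomial : ∀ {k} t (I : Fin t → Fin k) u → length (rowMonomial t I u) ≡ t
  length-rowMonomial zero    I u = refl
  length-rowMonomial (suc t) I u = cong suc (length-rowMonomial t (I ∘ suc) (u ∘ suc))

  𝟙-all≡eval : ∀ {k} t (I : Fin t → Fin k) u x → 𝟙 (all? (λ j → u j ≟ x (I j))) ≡ eval (rowMonomial t I u) x
  𝟙-all≡eval zero    I u x = refl
  𝟙-all≡eval (suc t) I u x = trans (𝟙-all t (λ j → u j ≟ x (I j)))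
    (cong (δ (u zero) (x (I zero)) *_) (𝟙-all≡eval t (I ∘ suc) (u ∘ suc) x))

  rows-spanned : ∀ k t (row : Row v t k) → Spanned k t (M t v k row)
  rows-spanned k t ((I , _) , u) =
    respects-cong (λ x → sym (𝟙-all≡eval t I u x))
      (spanned-monomial k t (rowMonomial t I u) (ℕ.≤-reflexive (length-rowMonomial t I u)))

  emptyRow : ∀ {k} → Row v 0 k
  emptyRow = ((λ ()) , (λ ())) , (λ ())

  liftRow : ∀ {s k} → Row v s k → Row v s (suc k)
  liftRow ((I , I↑) , u) = ((suc ∘ I) , (λ a b a<b → s≤s (I↑ a b a<b))) , u

  extendRow : ∀ {s k} → Fin v → Row v s k → Row v (suc s) (suc k)
  extendRow {s} {k} b ((I , I↑) , u) = (zero ∷ᵥ (suc ∘ I) , J↑) , (b ∷ᵥ u)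
    where
    J↑ : ∀ i j → i Data.Fin.< j → (zero ∷ᵥ (suc ∘ I)) i Data.Fin.< (zero ∷ᵥ (suc ∘ I)) j
    J↑ zero    (suc j) _         = s≤s z≤n
    J↑ (suc i) (suc j) (s≤s i<j) = s≤s (I↑ i j i<j)

  M-extendRow : ∀ s k b (row : Row v s k) x →
                M (suc s) v (suc k) (extendRow b row) x ≡ δ b (x zero) * M s v k row (tail x)
  M-extendRow s k b ((I , I↑) , u) x = 𝟙-all s (λ j → (b ∷ᵥ u) j ≟ x ((zero ∷ᵥ (suc ∘ I)) j))

  respects-const : ∀ {k} → Respects (M 0 v k) (λ _ → 1ℚ)
  respects-const {k} = respects-row (M 0 v k) emptyRow

  -- A function of the tail coordinates respecting `M s` on them respects `M s` and,
  -- as rows on the tail are sums of extended rows, also `M (s+1)`.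
  respects-lift : ∀ {s k h} → Respects (M s v k) h → Respects (M s v (suc k)) (h ∘ tail)
  respects-lift {s} {k} {h} resp =
    respects-trans (λ row x → M s v k row (tail x)) (λ row → respects-row (M s v (suc k)) (liftRow row))
      (respects-∘ {A = M s v k} {h = h} tail resp)

  respects-lift⁺ : ∀ {s k h} → Respects (M s v k) h → Respects (M (suc s) v (suc k)) (h ∘ tail)
  respects-lift⁺ {s} {k} {h} resp =
    respects-trans (λ row x → M s v k row (tail x)) lifted-row (respects-∘ {A = M s v k} {h = h} tail resp)
    where
    lifted-row : ∀ row → Respects (M (suc s) v (suc k)) (λ x → M s v k row (tail x))
    lifted-row row = respects-lincomb v (λ _ → 1ℚ) (λ b → M (suc s) v (suc k) (extendRow b row))
      (λ x → sym (trans (∑-cong v (λ b → trans (ℚ.*-identityˡ _) (M-extendRow s k b row x)))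
                        (∑-δ v (λ _ → M s v k row (tail x)) (x zero))))
      (λ b → respects-row (M (suc s) v (suc k)) (extendRow b row))

  respects-block : ∀ {s k h} b → Respects (M s v k) h →
                   Respects (M (suc s) v (suc k)) (λ x → δ b (x zero) * h (tail x))
  respects-block {s} {k} {h} b resp =
    respects-trans (λ row x → δ b (x zero) * M s v k row (tail x))
      (λ row → respects-cong (M-extendRow s k b row) (respects-row (M (suc s) v (suc k)) (extendRow b row)))
      (respects-scale {h = h ∘ tail} (λ x → δ b (x zero)) (respects-∘ {A = M s v k} {h = h} tail resp))

  ⊓-suc : ∀ t k → (suc t ⊓ k ≡ suc (t ⊓ k)) ⊎ (suc t ⊓ k ≡ t ⊓ k)
  ⊓-suc zero    zero    = inj₂ refl
  ⊓-suc (suc t) zero    = inj₂ refl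
  ⊓-suc zero    (suc k) = inj₁ refl
  ⊓-suc (suc t) (suc k) = Data.Sum.map (cong suc) (cong suc) (⊓-suc t k)

  respects-lift-either : ∀ {s s′ k h} → (s′ ≡ suc s) ⊎ (s′ ≡ s) → Respects (M s′ v k) h →
                         Respects (M (suc s) v (suc k)) (h ∘ tail)
  respects-lift-either (inj₁ refl) = respects-lift
  respects-lift-either (inj₂ refl) = respects-lift⁺

  G-respects-M : ∀ k t Q → Respects (M (t ⊓ k) v k) (λ x → G k t x Q)
  G-respects-M zero    zero    Q = respects-const
  G-respects-M zero    (suc t) Q = respects-const
  G-respects-M (suc k) zero    Q = respects-const
  G-respects-M (suc k) (suc t)   =
    ∀-++ (N k (suc t)) (w ℕ.* N k t) {λ Q → Respects (M (suc (t ⊓ k)) v (suc k)) (λ x → G (suc k) (suc t) x Q)}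
    (λ Q → respects-cong (λ x → sym (G-first k t x Q)) (respects-lift-either (⊓-suc t k) (G-respects-M k (suc t) Q)))
    (∀-combine w (N k t) (λ a Q →
      respects-cong (λ x → sym (G-block k t x a Q)) (respects-block (suc a) (G-respects-M k t Q))))

theorem1 : (v k t : ℕ) → v ≥ 1 → k ≥ 1 → t ≤ k →
    HasRank (M t v k) (rankFormula v k t)
theorem1 (suc w) k t _ _ t≤k =
  subst (HasRank (M t v k)) (N≡rankFormula k t)
    (rank-from-basis (M t v k) (N k t) (GRow k t)
      (rows-spanned k t)
      (λ P → subst (λ s → Respects (M s v k) (GRow k t P)) (ℕ.m≤n⇒m⊓n≡m t≤k) (G-respects-M k t P))
      (X k t) (indep-X k t))
  where
  open Basis w
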